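{- Let $A=(a_{i,j})$ be any $r\times r$ symmetrisable generalised Cartan matrix and let $S$ be any semi-ring. For $f\in \mathrm{Frieze}(A,S)$ define $p_{A,S}(f):[1,r]\times\mathbb{Z}\to S$ by \[ p_{A,S}(f)(i,m)=\prod_{j=i+1}^r f(j,m)^{ -a_{j,i}}\;\prod_{j=1}^{i-1} f(j,m+1)^{ -a_{j,i}}. \] Then $p_{A,S}(f)\in \mathrm{YFrieze}(A,S)$ for every $f\in\mathrm{Frieze}(A,S)$; that is, $p_{A,S}$ is a well-defined map $\mathrm{Frieze}(A,S)\to\mathrm{YFrieze}(A,S)$.
   Context: A symmetrisable generalised Cartan matrix is an integer $r\times r$ matrix $A=(a_{i,j})$ with $a_{i,i}=2$, $a_{i,j}\le 0$ for $i\ne j$, $a_{i,j}=0$ iff $a_{j,i}=0$, and such that $DA$ is symmetric for some diagonal matrix $D$ with positive diagonal entries. A semi-ring $(S,\cdot,+)$ is a set with an associative commutative multiplication having identity $1$, an associative commutative addition (no zero element required), and distributivity $(a+b)c=ac+bc$. Since $-a_{j,i}\ge 0$ for $j\neq i$, all products above are products of nonnegative powers (empty products and zeroth powers equal $1$). An $S$-valued frieze pattern associated to $A$ is a map $f:[1,r]\times\mathbb{Z}\to S$ with \[ f(i,m)f(i,m+1)=1+\prod_{j=i+1}^r f(j,m)^{ -a_{j,i}}\prod_{j=1}^{i-1}f(j,m+1)^{ -a_{j,i}}\quad\forall (i,m). \] An $S$-valued $\mathbf{Y}$-frieze pattern associated to $A$ is a map $k:[1,r]\times\mathbb{Z}\to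 S$ with \[ k(i,m)k(i,m+1)=\prod_{j=i+1}^r (1+k(j,m))^{ -a_{j,i}}\prod_{j=1}^{i-1}(1+k(j,m+1))^{ -a_{j,i}}\quad\forall (i,m). \] $\mathrm{Frieze}(A,S)$ and $\mathrm{YFrieze}(A,S)$ denote the sets of these. -}

module Defs where

open import Level using (Level; suc; _⊔_)
open import Data.Nat using (ℕ; zero; NonZero)
import Data.Nat as ℕ
open import Data.Integer using (ℤ; +_; ∣_∣) renaming (_≤_ to _≤ℤ_; _*_ to _*ℤ_)
import Data.Integer as ℤ
open import Data.Fin using (Fin) renaming (_<?_ to _<ᶠ?_)
open import Data.List using (List; foldr; map; allFin)
open import Data.Bool using (if_then_else_)
open import Data.Product using (Σ; _×_)
open import Relation.Nullary using (¬_; does)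
open import Relation.Binary.PropositionalEquality using (_≡_)
open import Relation.Binary.Core using (Rel)
open import Algebra.Core using (Op₂)
open import Algebra.Structures using (IsCommutativeSemigroup; IsCommutativeMonoid)
open import Algebra.Definitions using (_DistributesOverʳ_)

-- Symmetrisable generalised Cartan matrices (indices 1..r are Fin r)

record IsGCM (r : ℕ) (A : Fin r → Fin r → ℤ) : Set where
  field
    diag     : ∀ i → A i i ≡ + 2
    offdiag  : ∀ i j → ¬ (i ≡ j) → A i j ≤ℤ + 0
    zero-sym : ∀ i j → (A i j ≡ + 0 → A j i ≡ + 0) × (A j i ≡ + 0 → A i j ≡ + 0)

IsSymmetrisable : (r : ℕ) → (Fin r → Fin r → ℤ) → Set
IsSymmetrisable r A =
  Σ (Fin r → ℕ) λ d → (∀ i → NonZero (d i)) ×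
    (∀ i j → (+ d i) *ℤ A i j ≡ (+ d j) *ℤ A j i)

record SymGCM (r : ℕ) : Set where
  field
    A            : Fin r → Fin r → ℤ
    isGCM        : IsGCM r A
    symmetrisable : IsSymmetrisable r A

-- Semi-rings in the sense of the paper (no additive zero required)

record SemiRing c ℓ : Set (suc (c ⊔ ℓ)) where
  infixl 7 _*_
  infixl 6 _+_
  infix  4 _≈_
  field
    Carrier  : Set c
    _≈_      : Rel Carrier ℓ
    _+_      : Op₂ Carrier
    _*_      : Op₂ Carrier
    1#       : Carrier
    +-isCommutativeSemigroup : IsCommutativeSemigroup _≈_ _+_
    *-isCommutativeMonoid    : IsCommutativeMonoid _≈_ _*_ 1#
    distribʳ : _DistributesOverʳ_ _≈_ _*_ _+_

module _ {c ℓ} (S : SemiRing c ℓ) where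
  open SemiRing S

  pow : Carrier → ℕ → Carrier
  pow x zero      = 1#
  pow x (ℕ.suc n) = x * pow x n

  prodL : List Carrier → Carrier
  prodL = foldr _*_ 1#

  module _ {r : ℕ} (C : SymGCM r) where
    open SymGCM C

    -- Π_{j>i} g(j,m)^{-a_{j,i}} · Π_{j<i} g(j,m+1)^{-a_{j,i}}
    -- (for j ≠ i, a_{j,i} ≤ 0 so -a_{j,i} = ∣ a_{j,i} ∣)
    Prod : (Fin r → ℤ → Carrier) → Fin r → ℤ → Carrier
    Prod g i m = prodL (map term (allFin r))
      where
      term : Fin r → Carrier
      term j = if does (i <ᶠ? j) then pow (g j m) ∣ A j i ∣
               else if does (j <ᶠ? i) then pow (g j (m ℤ.+ + 1)) ∣ A j i ∣
               else 1#

    IsFrieze : (Fin r → ℤ → Carrier) → Set ℓ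
    IsFrieze f = ∀ i m → f i m * f i (m ℤ.+ + 1) ≈ 1# + Prod f i m

    IsYFrieze : (Fin r → ℤ → Carrier) → Set ℓ
    IsYFrieze k = ∀ i m → k i m * k i (m ℤ.+ + 1) ≈ Prod (λ j n → 1# + k j n) i m

    p : (Fin r → ℤ → Carrier) → (Fin r → ℤ → Carrier)
    p f = Prod f

-- The entries of p f in column m are products of powers of entries of f in columns m and m + 1.
-- Multiplying two consecutive columns of p f therefore replaces every f(j,n) by f(j,n) f(j,n+1),
-- which the frieze relation rewrites as 1 + p f(j,n): this is the Y-frieze relation.
module Submission where

open import Defs
open import Data.Nat using (ℕ; zero; suc)
open import Data.Integer using (ℤ; +_; ∣_∣)
import Data.Integer as ℤ
open import Data.Fin using (Fin) renaming (_<?_ to _<ᶠ?_)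
open import Data.List using ([]; _∷_; foldr; map; allFin)
open import Data.Bool using (true; false; if_then_else_)
open import Relation.Nullary using (does)
open import Relation.Binary.PropositionalEquality using (_≡_; refl; cong)
open import Algebra.Bundles using (CommutativeMonoid)

module _ {a ℓ} (M : CommutativeMonoid a ℓ) where
  open CommutativeMonoid M
  open import Algebra.Properties.CommutativeSemigroup commutativeSemigroup using (interchange)
  open import Algebra.Properties.CommutativeMonoid.Mult M using (_×_; ×-congʳ; ×-distrib-+)

  ×-∙-cong : ∀ n {x y z} → x ∙ y ≈ z → n × x ∙ n × y ≈ n × z
  ×-∙-cong n {x} {y} xy≈z = trans (sym (×-distrib-+ x y n)) (×-congʳ n xy≈z)

  foldr-map-∙ : ∀ {A : Set} (f g h : A → Carrier) → (∀ x → f x ∙ g x ≈ h x) →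
                ∀ xs → foldr _∙_ ε (map f xs) ∙ foldr _∙_ ε (map g xs) ≈ foldr _∙_ ε (map h xs)
  foldr-map-∙ f g h fg≈h []       = identityˡ ε
  foldr-map-∙ f g h fg≈h (x ∷ xs) =
    trans (interchange (f x) _ (g x) _) (∙-cong (fg≈h x) (foldr-map-∙ f g h fg≈h xs))

module _ {c ℓ} (S : SemiRing c ℓ) where
  open SemiRing S

  *-commutativeMonoid : CommutativeMonoid c ℓ
  *-commutativeMonoid = record { isCommutativeMonoid = *-isCommutativeMonoid }

  open CommutativeMonoid *-commutativeMonoid using (trans; identityˡ)
  open import Algebra.Properties.CommutativeMonoid.Mult *-commutativeMonoid using (_×_)

  pow≡× : ∀ x n → pow S x n ≡ n × x
  pow≡× x zero    = refl
  pow≡× x (suc n) = cong (x *_) (pow≡× x n)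

  pow-*-cong : ∀ n {x y z} → x * y ≈ z → pow S x n * pow S y n ≈ pow S z n
  pow-*-cong n {x} {y} {z} xy≈z
    rewrite pow≡× x n | pow≡× y n | pow≡× z n = ×-∙-cong *-commutativeMonoid n xy≈z

  module _ {r : ℕ} (C : SymGCM r) where
    open SymGCM C

    factor : (Fin r → ℤ → Carrier) → Fin r → ℤ → Fin r → Carrier
    factor g i m j = if does (i <ᶠ? j) then pow S (g j m) ∣ A j i ∣
                     else if does (j <ᶠ? i) then pow S (g j (m ℤ.+ + 1)) ∣ A j i ∣
                     else 1#

    module _ {g h : Fin r → ℤ → Carrier} (consecutive : ∀ j n → g j n * g j (n ℤ.+ + 1) ≈ h j n) where

      factor-consecutive : ∀ i m j → factor g i m j * factor g i (m ℤ.+ + 1) j ≈ factor h i m j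
      factor-consecutive i m j with does (i <ᶠ? j) | does (j <ᶠ? i)
      ... | true  | _     = pow-*-cong ∣ A j i ∣ (consecutive j m)
      ... | false | true  = pow-*-cong ∣ A j i ∣ (consecutive j (m ℤ.+ + 1))
      ... | false | false = identityˡ 1#

      Prod-consecutive : ∀ i m → Prod S C g i m * Prod S C g i (m ℤ.+ + 1) ≈ Prod S C h i m
      Prod-consecutive i m =
        foldr-map-∙ *-commutativeMonoid (factor g i m) (factor g i (m ℤ.+ + 1)) (factor h i m)
          (factor-consecutive i m) (allFin r)

theorem2p8 : ∀ {c ℓ} (S : SemiRing c ℓ) (r : ℕ) (C : SymGCM r) f →
    IsFrieze S C f → IsYFrieze S C (p S C f)
theorem2p8 S r C f isFrieze = Prod-consecutive S C isFrieze
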